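{- Let $\varphi$ be a $\mathrm{D}$-formula. (1) If $row$ is a $\varphi$-row and $A$ a $\varphi$-atom, then $succ_\varphi(row,A)$ is a $\varphi$-row. (2) If $row$ is a $\varphi$-row of the form $row=row_1\cdot row_2$ (with $row_1,row_2$ nonempty) and $A$ is a $\varphi$-atom, then $succ_\varphi(row,A)=succ_\varphi(row_1,A)\star succ_\varphi(row_2,A_1)$, where $A_1$ is the last atom of $succ_\varphi(row_1,A)$.
   Context: Formulas: $\varphi ::= p\mid\neg\varphi\mid\varphi\vee\varphi\mid\langle D\rangle\varphi$, $p\in\mathcal{AP}$; $[D]\psi:=\neg\langle D\rangle\neg\psi$. $\mathrm{CL}(\varphi)$: subformulas and their negations, identifying $\neg\neg\psi$ with $\psi$ and $\neg\langle D\rangle\psi$ with $[D]\neg\psi$. A $\varphi$-atom is $A\subseteq\mathrm{CL}(\varphi)$ with $\psi\in A$ iff $\neg\psi\notin A$, and $\psi_1\vee\psi_2\in A$ iff $\psi_1\in A$ or $\psi_2\in A$. $\mathcal{R}eq_D(A)=\{\psi:\langle D\rangle\psi\in A\}$, $\mathrm{REQ}_\varphi=\{\psi:\langle D\rangle\psi\in\mathrm{CL}(\varphi)\}$, $\mathcal{O}bs_D(A)=A\cap\mathrm{REQ}_\varphi$. $A\,D_\varphi\,A'$ iff for every $[D]\psi\in A$, $\psi\in A'$ and $[D]\psi\in A'$. $A_1A_2\Rightarrow A_3$ iff $A_3\cap\mathcal{AP}=A_1\cap A_2\cap\mathcal{AP}$ and $\mathcal{R}eq_D(A_3)=\mathcal{R}eq_D(A_1)\cup\mathcal{R}eq_D(A_2)\cup\mathcal{O}bs_D(A_1)\cup\mathcal{O}bs_D(A_2)$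 (for given $A_1,A_2$ such $A_3$ exists and is unique). A $\varphi$-row is a nonempty finite sequence $row[0]\cdots row[k-1]$ of atoms with $row[i+1]\,D_\varphi\,row[i]$ and $row[i]\cap\mathcal{AP}\supseteq row[i+1]\cap\mathcal{AP}$. For a row of length $n$ and atom $A$, $succ_\varphi(row,A)$ is the sequence $B_0\cdots B_n$ with $B_0=A$ and $row[i]B_i\Rightarrow B_{i+1}$ for $i\in[0,n-1]$. $w\cdot w'$ is concatenation; if the last letter of $w$ equals the first letter of $w'$, $w\star w'$ is $w$ followed by $w'$ with its first letter removed. -}

module Defs where

open import Data.Nat using (ℕ)
open import Data.Bool using (Bool; true; false)
open import Data.List using (List; []; _∷_; _++_; map; drop)
open import Data.List.Membership.Propositional using (_∈_)
open import Data.List.Relation.Unary.All using (All)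
open import Data.List.Relation.Binary.Pointwise using (Pointwise)
open import Data.Product using (_×_)
open import Data.Sum using (_⊎_)
open import Function.Bundles using (_⇔_)
open import Relation.Binary.PropositionalEquality using (_≡_)
open import Relation.Nullary using (¬_)

data Fm : Set where
  var : ℕ → Fm
  neg : Fm → Fm
  or  : Fm → Fm → Fm
  dia : Fm → Fm

-- Negation modulo the identification ¬¬ψ = ψ
infix 30 ∼_
∼_ : Fm → Fm
∼ neg ψ = ψ
∼ ψ     = neg ψ

-- Normal form of a formula modulo ¬¬ψ = ψ (applied everywhere).
-- Note ¬⟨D⟩ψ and [D]¬ψ = ¬⟨D⟩¬¬ψ then have the same normal form.
nf : Fm → Fm
nf (var p)  = var p
nf (neg ψ)  = ∼ (nf ψ)
nf (or a b) = or (nf a) (nf b)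
nf (dia ψ)  = dia (nf ψ)

box : Fm → Fm
box ψ = neg (dia (∼ ψ))

subs : Fm → List Fm
subs (var p)  = var p ∷ []
subs (neg a)  = neg a ∷ subs a
subs (or a b) = or a b ∷ (subs a ++ subs b)
subs (dia a)  = dia a ∷ subs a

CL : Fm → List Fm
CL φ = map nf (subs φ) ++ map (λ χ → ∼ (nf χ)) (subs φ)

FSet : Set
FSet = Fm → Bool

infix 4 _∈ₛ_
_∈ₛ_ : Fm → FSet → Set
ψ ∈ₛ A = A ψ ≡ true

infix 4 _≐_
_≐_ : FSet → FSet → Set
A ≐ B = ∀ ψ → A ψ ≡ B ψ

record IsAtom (φ : Fm) (A : FSet) : Set where
  field
    ⊆CL  : ∀ ψ → ψ ∈ₛ A → ψ ∈ CL φ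
    negA : ∀ ψ → ψ ∈ CL φ → (ψ ∈ₛ A ⇔ (¬ (∼ ψ ∈ₛ A)))
    orA  : ∀ a b → or a b ∈ CL φ → (or a b ∈ₛ A ⇔ (a ∈ₛ A ⊎ b ∈ₛ A))

InREQ : Fm → Fm → Set
InREQ φ ψ = dia ψ ∈ CL φ

InReq : FSet → Fm → Set
InReq A ψ = dia ψ ∈ₛ A

InObs : Fm → FSet → Fm → Set
InObs φ A ψ = ψ ∈ₛ A × InREQ φ ψ

-- A D_φ A' : for every [D]ψ ∈ A (i.e. ¬⟨D⟩χ ∈ A with ψ = ¬χ), ψ ∈ A' and [D]ψ ∈ A'
DRel : FSet → FSet → Set
DRel A A' = ∀ χ → neg (dia χ) ∈ₛ A → (∼ χ ∈ₛ A') × (neg (dia χ) ∈ₛ A')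

Arrow : Fm → FSet → FSet → FSet → Set
Arrow φ A₁ A₂ A₃ =
  IsAtom φ A₃ ×
  (∀ p → var p ∈ₛ A₃ ⇔ (var p ∈ₛ A₁ × var p ∈ₛ A₂)) ×
  (∀ ψ → InReq A₃ ψ ⇔ (InReq A₁ ψ ⊎ InReq A₂ ψ ⊎ InObs φ A₁ ψ ⊎ InObs φ A₂ ψ))

-- Consecutive-entry condition of a row: row[i] = A, row[i+1] = B
RowStep : FSet → FSet → Set
RowStep A B = DRel B A × (∀ p → var p ∈ₛ B → var p ∈ₛ A)

data Linked (R : FSet → FSet → Set) : List FSet → Set where
  [-]  : ∀ {x} → Linked R (x ∷ [])
  _∷_ : ∀ {x y xs} → R x y → Linked R (y ∷ xs) → Linked R (x ∷ y ∷ xs)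

-- φ-rows (nonempty finite sequences of atoms); nonemptiness is built into Linked
IsRow : Fm → List FSet → Set
IsRow φ row = All (IsAtom φ) row × Linked RowStep row

-- Succ φ row A Bs : Bs = succ_φ(row, A)  (B₀ = A, row[i] Bᵢ ⇒ Bᵢ₊₁)
data Succ (φ : Fm) : List FSet → FSet → List FSet → Set where
  base : ∀ {A} → Succ φ [] A (A ∷ [])
  step : ∀ {r rs A B Bs} → Arrow φ r A B → Succ φ rs B (B ∷ Bs) →
         Succ φ (r ∷ rs) A (A ∷ B ∷ Bs)

infixr 5 _⋆_
_⋆_ : List FSet → List FSet → List FSet
w ⋆ w' = w ++ drop 1 w'

infix 4 _≋_
_≋_ : List FSet → List FSet → Set
_≋_ = Pointwise _≐_

-- An atom is determined by its propositional variables and its diamond formulas, since the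
-- remaining members of CL(φ) are boolean combinations of these.  The arrow A₁A₂ ⇒ A₃ fixes
-- exactly that data of A₃, so A₃ is unique; it exists because evaluating CL(φ) under the
-- prescribed data yields an atom.  Hence succ_φ is a function, and (2) is its
-- compositionality.  For (1) it remains to check that every arrow step r A ⇒ B satisfies
-- B D_φ A: as Req(A) ∪ Obs(A) ⊆ Req(B), a box ¬⟨D⟩χ in B excludes both ⟨D⟩χ and χ from A.
-- Of the given row only the atomhood of its entries is ever used.
module Submission where

open import Defs
open import Data.Bool using (Bool; true; false; not; _∨_)
import Data.Bool.Properties as Bool
open import Data.Empty using (⊥-elim)
open import Data.List using (List; []; _∷_; _++_; _∷ʳ_; map)
open import Data.List.Membership.Propositional using (_∈_)
open import Data.List.Membership.Propositional.Properties
  using (∈-++⁻; ∈-++⁺ˡ; ∈-++⁺ʳ; ∈-map⁻; ∈-map⁺)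
open import Data.List.Properties using (∷ʳ-injective; ∷-injective)
open import Data.List.Relation.Binary.Pointwise using ([]; _∷_)
open import Data.List.Relation.Unary.All using (All; []; _∷_)
open import Data.List.Relation.Unary.Any using (here; there)
open import Data.Nat using (ℕ)
import Data.Nat.Properties as ℕ
open import Data.Product using (_×_; ∃; _,_; proj₁; proj₂; uncurry)
open import Data.Product.Function.NonDependent.Propositional using (_×-⇔_)
open import Data.Sum using (_⊎_; inj₁; inj₂; [_,_])
open import Data.Sum.Function.Propositional using (_⊎-⇔_)
open import Function using (_∘_; id)
open import Function.Bundles using (_⇔_; mk⇔; Equivalence)
open import Function.Construct.Composition using (_⇔-∘_)
open import Function.Construct.Identity using (⇔-id)
open import Function.Construct.Symmetry using (⇔-sym)
open import Function.Related.TypeIsomorphisms using (¬-cong-⇔)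
open import Relation.Binary.Definitions using (DecidableEquality)
open import Relation.Binary.PropositionalEquality
  using (_≡_; refl; sym; cong; cong₂; subst)
open import Relation.Nullary using (¬_; Dec; yes; no; does; contradiction)
open import Relation.Nullary.Decidable using (map′; _×-dec_; _⊎-dec_; decidable-stable)

open Equivalence

infix 4 _≟_
_≟_ : DecidableEquality Fm
var p   ≟ var q   = map′ (cong var) (λ { refl → refl }) (p ℕ.≟ q)
neg ψ   ≟ neg χ   = map′ (cong neg) (λ { refl → refl }) (ψ ≟ χ)
or ψ ψ′ ≟ or χ χ′ = map′ (uncurry (cong₂ or)) (λ { refl → refl , refl }) (ψ ≟ χ ×-dec ψ′ ≟ χ′)
dia ψ   ≟ dia χ   = map′ (cong dia) (λ { refl → refl }) (ψ ≟ χ)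
var _  ≟ neg _  = no λ ()
var _  ≟ or _ _ = no λ ()
var _  ≟ dia _  = no λ ()
neg _  ≟ var _  = no λ ()
neg _  ≟ or _ _ = no λ ()
neg _  ≟ dia _  = no λ ()
or _ _ ≟ var _  = no λ ()
or _ _ ≟ neg _  = no λ ()
or _ _ ≟ dia _  = no λ ()
dia _  ≟ var _  = no λ ()
dia _  ≟ neg _  = no λ ()
dia _  ≟ or _ _ = no λ ()

open import Data.List.Membership.DecPropositional _≟_ using (_∈?_)

infix 4 _∈ₛ?_
_∈ₛ?_ : (ψ : Fm) (A : FSet) → Dec (ψ ∈ₛ A)
ψ ∈ₛ? A = A ψ Bool.≟ true

does-≡-true : ∀ {P : Set} (P? : Dec P) → does P? ≡ true ⇔ P
does-≡-true (yes p) = mk⇔ (λ _ → p) (λ _ → refl)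
does-≡-true (no ¬p) = mk⇔ (λ ()) (λ p → contradiction p ¬p)

∨-≡-true : ∀ x {y} → x ∨ y ≡ true ⇔ (x ≡ true ⊎ y ≡ true)
∨-≡-true true  = mk⇔ inj₁ (λ _ → refl)
∨-≡-true false = mk⇔ inj₂ [ (λ ()) , id ]

≡-true⇔¬not : ∀ x → x ≡ true ⇔ (¬ not x ≡ true)
≡-true⇔¬not true  = mk⇔ (λ _ ()) (λ _ → refl)
≡-true⇔¬not false = mk⇔ (λ ()) (λ ¬t → contradiction refl ¬t)

≡-true-cong : ∀ {x y} → x ≡ y → x ≡ true ⇔ y ≡ true
≡-true-cong refl = ⇔-id _

≐-⇔ : ∀ {A B} → A ≐ B → ∀ ψ → ψ ∈ₛ A ⇔ ψ ∈ₛ B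
≐-⇔ A≐B ψ = ≡-true-cong (A≐B ψ)

⇔-≐ : ∀ {A B} → (∀ ψ → ψ ∈ₛ A ⇔ ψ ∈ₛ B) → A ≐ B
⇔-≐ A⇔B ψ = Bool.⇔→≡ (A⇔B ψ)

subs-refl : ∀ χ → χ ∈ subs χ
subs-refl (var p)  = here refl
subs-refl (neg χ)  = here refl
subs-refl (or χ θ) = here refl
subs-refl (dia χ)  = here refl

subs-trans : ∀ χ {θ ψ} → θ ∈ subs χ → ψ ∈ subs θ → ψ ∈ subs χ
subs-trans (var p)  (here refl) ψ∈ = ψ∈
subs-trans (neg χ)  (here refl) ψ∈ = ψ∈
subs-trans (neg χ)  (there θ∈)  ψ∈ = there (subs-trans χ θ∈ ψ∈)
subs-trans (dia χ)  (here refl) ψ∈ = ψ∈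
subs-trans (dia χ)  (there θ∈)  ψ∈ = there (subs-trans χ θ∈ ψ∈)
subs-trans (or χ χ′) (here refl) ψ∈ = ψ∈
subs-trans (or χ χ′) (there θ∈) ψ∈ with ∈-++⁻ (subs χ) θ∈
... | inj₁ θ∈χ  = there (∈-++⁺ˡ (subs-trans χ θ∈χ ψ∈))
... | inj₂ θ∈χ′ = there (∈-++⁺ʳ (subs χ) (subs-trans χ′ θ∈χ′ ψ∈))

subs-∼ : ∀ χ {ψ} → ψ ∈ subs (∼ χ) → ψ ≡ ∼ χ ⊎ ψ ∈ subs χ
subs-∼ (neg χ)  ψ∈          = inj₂ (there ψ∈)
subs-∼ (var p)  (here refl) = inj₁ refl
subs-∼ (var p)  (there ψ∈)  = inj₂ ψ∈
subs-∼ (or χ θ) (here refl) = inj₁ refl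
subs-∼ (or χ θ) (there ψ∈)  = inj₂ ψ∈
subs-∼ (dia χ)  (here refl) = inj₁ refl
subs-∼ (dia χ)  (there ψ∈)  = inj₂ ψ∈

subs-nf : ∀ χ {ψ} → ψ ∈ subs (nf χ) → ∃ λ θ → θ ∈ subs χ × ψ ≡ nf θ
subs-nf (var p) (here refl) = var p , here refl , refl
subs-nf (neg χ) ψ∈ with subs-∼ (nf χ) ψ∈
... | inj₁ refl = neg χ , here refl , refl
... | inj₂ ψ∈′ with subs-nf χ ψ∈′
...   | θ , θ∈ , refl = θ , there θ∈ , refl
subs-nf (dia χ) (here refl) = dia χ , here refl , refl
subs-nf (dia χ) (there ψ∈) with subs-nf χ ψ∈
... | θ , θ∈ , refl = θ , there θ∈ , refl
subs-nf (or χ χ′) (here refl) = or χ χ′ , here refl , refl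
subs-nf (or χ χ′) (there ψ∈) with ∈-++⁻ (subs (nf χ)) ψ∈
... | inj₁ ψ∈χ with subs-nf χ ψ∈χ
...   | θ , θ∈ , refl = θ , there (∈-++⁺ˡ θ∈) , refl
subs-nf (or χ χ′) (there ψ∈) | inj₂ ψ∈χ′ with subs-nf χ′ ψ∈χ′
...   | θ , θ∈ , refl = θ , there (∈-++⁺ʳ (subs χ) θ∈) , refl

∼∼-subs : ∀ χ → ∼ ∼ χ ≡ χ ⊎ ∼ ∼ χ ∈ subs χ
∼∼-subs (var p)        = inj₁ refl
∼∼-subs (or χ θ)       = inj₁ refl
∼∼-subs (dia χ)        = inj₁ refl
∼∼-subs (neg (var p))  = inj₁ refl
∼∼-subs (neg (neg χ))  = inj₂ (there (there (subs-refl χ)))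
∼∼-subs (neg (or χ θ)) = inj₁ refl
∼∼-subs (neg (dia χ))  = inj₁ refl

eval : (ℕ → Bool) → (Fm → Bool) → Fm → Bool
eval val diam (var p)  = val p
eval val diam (neg ψ)  = not (eval val diam ψ)
eval val diam (or ψ χ) = eval val diam ψ ∨ eval val diam χ
eval val diam (dia ψ)  = diam ψ

eval-∼ : ∀ val diam ψ → eval val diam (∼ ψ) ≡ not (eval val diam ψ)
eval-∼ val diam (neg ψ)  = sym (Bool.not-involutive (eval val diam ψ))
eval-∼ val diam (var p)  = refl
eval-∼ val diam (or ψ χ) = refl
eval-∼ val diam (dia ψ)  = refl

module _ (φ : Fm) where

  ∈CL-nf : ∀ {χ} → χ ∈ subs φ → nf χ ∈ CL φ
  ∈CL-nf χ∈ = ∈-++⁺ˡ (∈-map⁺ nf χ∈)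

  ∈CL-∼nf : ∀ {χ} → χ ∈ subs φ → ∼ nf χ ∈ CL φ
  ∈CL-∼nf χ∈ = ∈-++⁺ʳ (map nf (subs φ)) (∈-map⁺ (λ χ → ∼ nf χ) χ∈)

  ∈CL⁻ : ∀ {ψ} → ψ ∈ CL φ → ∃ λ χ → χ ∈ subs φ × (ψ ≡ nf χ ⊎ ψ ≡ ∼ nf χ)
  ∈CL⁻ ψ∈ with ∈-++⁻ (map nf (subs φ)) ψ∈
  ... | inj₁ ψ∈nf with ∈-map⁻ nf ψ∈nf
  ...   | χ , χ∈ , eq = χ , χ∈ , inj₁ eq
  ∈CL⁻ ψ∈ | inj₂ ψ∈∼nf with ∈-map⁻ (λ χ → ∼ nf χ) ψ∈∼nf
  ...   | χ , χ∈ , eq = χ , χ∈ , inj₂ eq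

  subs-nf-∈CL : ∀ {χ ψ} → χ ∈ subs φ → ψ ∈ subs (nf χ) → ψ ∈ CL φ
  subs-nf-∈CL {χ} χ∈ ψ∈ with subs-nf χ ψ∈
  ... | θ , θ∈ , refl = ∈CL-nf (subs-trans φ χ∈ θ∈)

  CL-subs-closed : ∀ {ψ θ} → ψ ∈ CL φ → θ ∈ subs ψ → θ ∈ CL φ
  CL-subs-closed ψ∈ θ∈ with ∈CL⁻ ψ∈
  ... | χ , χ∈ , inj₁ refl = subs-nf-∈CL χ∈ θ∈
  ... | χ , χ∈ , inj₂ refl with subs-∼ (nf χ) θ∈
  ...   | inj₁ refl = ψ∈
  ...   | inj₂ θ∈′  = subs-nf-∈CL χ∈ θ∈′

  CL-∼-closed : ∀ {ψ} → ψ ∈ CL φ → ∼ ψ ∈ CL φ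
  CL-∼-closed ψ∈ with ∈CL⁻ ψ∈
  ... | χ , χ∈ , inj₁ refl = ∈CL-∼nf χ∈
  ... | χ , χ∈ , inj₂ refl with ∼∼-subs (nf χ)
  ...   | inj₁ eq  = subst (_∈ CL φ) (sym eq) (∈CL-nf χ∈)
  ...   | inj₂ ∼∼∈ = subs-nf-∈CL χ∈ ∼∼∈

  ∈CL-orˡ : ∀ {ψ χ} → or ψ χ ∈ CL φ → ψ ∈ CL φ
  ∈CL-orˡ {ψ} ∈CL = CL-subs-closed ∈CL (there (∈-++⁺ˡ (subs-refl ψ)))

  ∈CL-orʳ : ∀ {ψ χ} → or ψ χ ∈ CL φ → χ ∈ CL φ
  ∈CL-orʳ {ψ} {χ} ∈CL = CL-subs-closed ∈CL (there (∈-++⁺ʳ (subs ψ) (subs-refl χ)))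

  ∈CL-neg : ∀ {ψ} → neg ψ ∈ CL φ → ψ ∈ CL φ
  ∈CL-neg {ψ} ∈CL = CL-subs-closed ∈CL (there (subs-refl ψ))

  ∈CL-dia : ∀ {ψ} → dia ψ ∈ CL φ → ψ ∈ CL φ
  ∈CL-dia {ψ} ∈CL = CL-subs-closed ∈CL (there (subs-refl ψ))

  module _ {A : FSet} (atom : IsAtom φ A) where
    open IsAtom atom

    atom-∼-∉ : ∀ {ψ} → ψ ∈ CL φ → ∼ ψ ∈ₛ A → ¬ ψ ∈ₛ A
    atom-∼-∉ {ψ} ψ∈ ∼ψ∈A ψ∈A = to (negA ψ ψ∈) ψ∈A ∼ψ∈A

    atom-∉-∼ : ∀ {ψ} → ψ ∈ CL φ → ¬ ψ ∈ₛ A → ∼ ψ ∈ₛ A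
    atom-∉-∼ {ψ} ψ∈ ψ∉A = decidable-stable (∼ ψ ∈ₛ? A) (ψ∉A ∘ from (negA ψ ψ∈))

  atom-≐-by-vars-and-dias : ∀ {B B′} → IsAtom φ B → IsAtom φ B′ →
            (∀ p → var p ∈ₛ B ⇔ var p ∈ₛ B′) → (∀ ψ → dia ψ ∈ₛ B ⇔ dia ψ ∈ₛ B′) →
            B ≐ B′
  atom-≐-by-vars-and-dias {B} {B′} atom atom′ vars dias = ⇔-≐ agree
    where
    open IsAtom
    agreeCL : ∀ ψ → ψ ∈ CL φ → ψ ∈ₛ B ⇔ ψ ∈ₛ B′
    agreeCL (var p)  _  = vars p
    agreeCL (dia ψ)  _  = dias ψ
    agreeCL (neg ψ)  ∈CL =
      ⇔-sym (negA atom′ (neg ψ) ∈CL)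
        ⇔-∘ (¬-cong-⇔ (agreeCL ψ (∈CL-neg ∈CL)) ⇔-∘ negA atom (neg ψ) ∈CL)
    agreeCL (or ψ χ) ∈CL =
      ⇔-sym (orA atom′ ψ χ ∈CL)
        ⇔-∘ ((agreeCL ψ (∈CL-orˡ ∈CL) ⊎-⇔ agreeCL χ (∈CL-orʳ ∈CL)) ⇔-∘ orA atom ψ χ ∈CL)
    agree : ∀ ψ → ψ ∈ₛ B ⇔ ψ ∈ₛ B′
    agree ψ with ψ ∈? CL φ
    ... | yes ∈CL = agreeCL ψ ∈CL
    ... | no ∉CL  = mk⇔ (⊥-elim ∘ ∉CL ∘ ⊆CL atom ψ) (⊥-elim ∘ ∉CL ∘ ⊆CL atom′ ψ)

  evalAtom : (ℕ → Bool) → (Fm → Bool) → FSet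
  evalAtom val diam ψ = does (ψ ∈? CL φ ×-dec eval val diam ψ Bool.≟ true)

  module _ (val : ℕ → Bool) (diam : Fm → Bool) where

    ∈-evalAtom : ∀ ψ → ψ ∈ₛ evalAtom val diam ⇔ (ψ ∈ CL φ × eval val diam ψ ≡ true)
    ∈-evalAtom ψ = does-≡-true (ψ ∈? CL φ ×-dec eval val diam ψ Bool.≟ true)

    evalAtom-on-CL : ∀ {ψ} → ψ ∈ CL φ → ψ ∈ₛ evalAtom val diam ⇔ eval val diam ψ ≡ true
    evalAtom-on-CL ∈CL = mk⇔ (proj₂ ∘ to (∈-evalAtom _)) (from (∈-evalAtom _) ∘ (∈CL ,_))

    evalAtom-isAtom : IsAtom φ (evalAtom val diam)
    evalAtom-isAtom = record
      { ⊆CL  = λ ψ → proj₁ ∘ to (∈-evalAtom ψ)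
      ; negA = negA
      ; orA  = orA
      }
      where
      negA : ∀ ψ → ψ ∈ CL φ → ψ ∈ₛ evalAtom val diam ⇔ (¬ ∼ ψ ∈ₛ evalAtom val diam)
      negA ψ ∈CL =
        ⇔-sym (¬-cong-⇔ (≡-true-cong (eval-∼ val diam ψ) ⇔-∘ evalAtom-on-CL (CL-∼-closed ∈CL)))
          ⇔-∘ (≡-true⇔¬not (eval val diam ψ) ⇔-∘ evalAtom-on-CL ∈CL)
      orA : ∀ ψ χ → or ψ χ ∈ CL φ →
            or ψ χ ∈ₛ evalAtom val diam ⇔ (ψ ∈ₛ evalAtom val diam ⊎ χ ∈ₛ evalAtom val diam)
      orA ψ χ ∈CL =
        (⇔-sym (evalAtom-on-CL (∈CL-orˡ ∈CL)) ⊎-⇔ ⇔-sym (evalAtom-on-CL (∈CL-orʳ ∈CL)))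
          ⇔-∘ (∨-≡-true (eval val diam ψ) ⇔-∘ evalAtom-on-CL ∈CL)

    ∈-evalAtom-within : ∀ {ψ} {Q : Set} → eval val diam ψ ≡ true ⇔ Q → (Q → ψ ∈ CL φ) →
                        ψ ∈ₛ evalAtom val diam ⇔ Q
    ∈-evalAtom-within eval⇔Q Q⇒∈CL =
      mk⇔ (to eval⇔Q ∘ proj₂ ∘ to (∈-evalAtom _))
          (λ q → from (∈-evalAtom _) (Q⇒∈CL q , from eval⇔Q q))

  succVal? : ∀ r A p → Dec (var p ∈ₛ r × var p ∈ₛ A)
  succVal? r A p = var p ∈ₛ? r ×-dec var p ∈ₛ? A

  succReq? : ∀ r A ψ → Dec (InReq r ψ ⊎ InReq A ψ ⊎ InObs φ r ψ ⊎ InObs φ A ψ)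
  succReq? r A ψ = dia ψ ∈ₛ? r ⊎-dec dia ψ ∈ₛ? A ⊎-dec
                   (ψ ∈ₛ? r ×-dec dia ψ ∈? CL φ) ⊎-dec (ψ ∈ₛ? A ×-dec dia ψ ∈? CL φ)

  succAtom : FSet → FSet → FSet
  succAtom r A = evalAtom (does ∘ succVal? r A) (does ∘ succReq? r A)

  succAtom-arrow : ∀ {r A} → IsAtom φ r → IsAtom φ A → Arrow φ r A (succAtom r A)
  succAtom-arrow {r} {A} atomʳ atomᴬ =
    evalAtom-isAtom val req ,
    (λ p → ∈-evalAtom-within val req (does-≡-true (succVal? r A p)) (IsAtom.⊆CL atomʳ _ ∘ proj₁)) ,
    (λ ψ → ∈-evalAtom-within val req (does-≡-true (succReq? r A ψ))
             [ IsAtom.⊆CL atomʳ _ , [ IsAtom.⊆CL atomᴬ _ , [ proj₂ , proj₂ ] ] ])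
    where
    val = does ∘ succVal? r A
    req = does ∘ succReq? r A

  arrow-unique : ∀ {r A A′ B B′} → A ≐ A′ → Arrow φ r A B → Arrow φ r A′ B′ → B ≐ B′
  arrow-unique A≐A′ (atom , vars , reqs) (atom′ , vars′ , reqs′) =
    atom-≐-by-vars-and-dias atom atom′
      (λ p → ⇔-sym (vars′ p) ⇔-∘ ((⇔-id _ ×-⇔ A⇔A′ (var p)) ⇔-∘ vars p))
      (λ ψ → ⇔-sym (reqs′ ψ)
               ⇔-∘ ((⇔-id _ ⊎-⇔ A⇔A′ (dia ψ) ⊎-⇔ ⇔-id _ ⊎-⇔ (A⇔A′ ψ ×-⇔ ⇔-id _)) ⇔-∘ reqs ψ))
    where
    A⇔A′ = ≐-⇔ A≐A′

  arrow-rowStep : ∀ {r A B} → IsAtom φ A → Arrow φ r A B → RowStep A B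
  arrow-rowStep {A = A} {B} atomᴬ (atomᴮ , vars , reqs) = boxes , (λ p → proj₂ ∘ to (vars p))
    where
    boxes : DRel B A
    boxes χ □∈B = atom-∉-∼ atomᴬ χ∈CL χ∉A , atom-∉-∼ atomᴬ ◇χ∈CL ◇χ∉A
      where
      ◇χ∈CL = ∈CL-neg (IsAtom.⊆CL atomᴮ _ □∈B)
      χ∈CL  = ∈CL-dia ◇χ∈CL
      ◇χ∉B : ¬ dia χ ∈ₛ B
      ◇χ∉B = atom-∼-∉ atomᴮ ◇χ∈CL □∈B
      ◇χ∉A : ¬ dia χ ∈ₛ A
      ◇χ∉A = ◇χ∉B ∘ from (reqs χ) ∘ inj₂ ∘ inj₁
      χ∉A : ¬ χ ∈ₛ A
      χ∉A χ∈A = ◇χ∉B (from (reqs χ) (inj₂ (inj₂ (inj₂ (χ∈A , ◇χ∈CL)))))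

  succ-exists : ∀ {row A} → All (IsAtom φ) row → IsAtom φ A → ∃ λ Bs → Succ φ row A (A ∷ Bs)
  succ-exists []               atomᴬ = [] , base
  succ-exists (atomʳ ∷ atomsʳ) atomᴬ with succ-exists atomsʳ (proj₁ (succAtom-arrow atomʳ atomᴬ))
  ... | Bs , succ = _ ∷ Bs , step (succAtom-arrow atomʳ atomᴬ) succ

  succ-isRow : ∀ {row A Bs} → IsAtom φ A → Succ φ row A Bs → IsRow φ Bs
  succ-isRow atomᴬ base = atomᴬ ∷ [] , [-]
  succ-isRow atomᴬ (step arrow succ) with succ-isRow (proj₁ arrow) succ
  ... | atoms , linked = atomᴬ ∷ atoms , arrow-rowStep atomᴬ arrow ∷ linked

  succ-unique : ∀ {row A A′ Bs Bs′} → A ≐ A′ → Succ φ row A Bs → Succ φ row A′ Bs′ → Bs ≋ Bs′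
  succ-unique A≐A′ base              base                = A≐A′ ∷ []
  succ-unique A≐A′ (step arrow succ) (step arrow′ succ′) =
    A≐A′ ∷ succ-unique (arrow-unique A≐A′ arrow arrow′) succ succ′

  succ-⋆-identityˡ : ∀ {row A Bs} → Succ φ row A Bs → (A ∷ []) ⋆ Bs ≡ Bs
  succ-⋆-identityˡ base       = refl
  succ-⋆-identityˡ (step _ _) = refl

  -- The equation Es ≡ Cs ∷ʳ D stands in for matching on Cs ∷ʳ D, which does not unify.
  succ-++ : ∀ xs {ys A A′ Bs Es Cs D Ds} → A ≐ A′ →
            Succ φ (xs ++ ys) A Bs → Succ φ xs A′ Es → Es ≡ Cs ∷ʳ D → Succ φ ys D Ds →
            Bs ≋ (Cs ∷ʳ D) ⋆ Ds
  succ-++ [] {Bs = Bs} {Cs = Cs} A≐A′ succ base Es≡ succ₂ with ∷ʳ-injective [] Cs Es≡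
  ... | refl , refl = subst (Bs ≋_) (sym (succ-⋆-identityˡ succ₂)) (succ-unique A≐A′ succ succ₂)
  succ-++ (x ∷ xs) {Cs = []}     A≐A′ (step _ _) (step _ _) () _
  succ-++ (x ∷ xs) {Cs = C ∷ Cs} A≐A′ (step arrow succ) (step arrow₁ succ₁) Es≡ succ₂
    with ∷-injective Es≡
  ... | refl , Es≡′ = A≐A′ ∷ succ-++ xs (arrow-unique A≐A′ arrow arrow₁) succ succ₁ Es≡′ succ₂

lemma3p8 : (φ : Fm) →
    -- (1)
    (∀ (row : List FSet) (A : FSet) → IsRow φ row → IsAtom φ A →
       (∃ λ Bs → Succ φ row A Bs) ×
       (∀ Bs → Succ φ row A Bs → IsRow φ Bs)) ×
    -- (2)
    (∀ (r₁ r₂ : FSet) (row₁ row₂ : List FSet) (A : FSet) →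
       IsRow φ ((r₁ ∷ row₁) ++ (r₂ ∷ row₂)) → IsAtom φ A →
       ∀ Bs init₁ A₁ Bs₂ →
       Succ φ ((r₁ ∷ row₁) ++ (r₂ ∷ row₂)) A Bs →
       Succ φ (r₁ ∷ row₁) A (init₁ ∷ʳ A₁) →
       Succ φ (r₂ ∷ row₂) A₁ Bs₂ →
       Bs ≋ ((init₁ ∷ʳ A₁) ⋆ Bs₂))
lemma3p8 φ = part₁ , part₂
  where
  part₁ : ∀ row A → IsRow φ row → IsAtom φ A →
          (∃ λ Bs → Succ φ row A Bs) × (∀ Bs → Succ φ row A Bs → IsRow φ Bs)
  part₁ row A (atoms , _) atomᴬ with succ-exists φ atoms atomᴬ
  ... | Bs , succ = (A ∷ Bs , succ) , λ _ → succ-isRow φ atomᴬ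

  part₂ : ∀ r₁ r₂ row₁ row₂ A → IsRow φ ((r₁ ∷ row₁) ++ (r₂ ∷ row₂)) → IsAtom φ A →
          ∀ Bs init₁ A₁ Bs₂ →
          Succ φ ((r₁ ∷ row₁) ++ (r₂ ∷ row₂)) A Bs → Succ φ (r₁ ∷ row₁) A (init₁ ∷ʳ A₁) →
          Succ φ (r₂ ∷ row₂) A₁ Bs₂ → Bs ≋ ((init₁ ∷ʳ A₁) ⋆ Bs₂)
  part₂ r₁ r₂ row₁ row₂ _ _ _ _ _ _ _ succ succ₁ succ₂ =
    succ-++ φ (r₁ ∷ row₁) (λ _ → refl) succ succ₁ refl succ₂
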